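{- If $(d_A,d_B)$ is a bipartite degree sequence that has realizations with matching numbers $\nu_{\min}$ and $\nu_{\max}$, and $\nu$ is an integer with $\nu_{\min}\leq\nu\leq\nu_{\max}$, then $(d_A,d_B)$ has a realization with matching number $\nu$.
   Context: All graphs are finite, simple and undirected. For a bipartite graph with fixed partite sets $A$, $B$, its bipartite degree sequence is the pair $(d_A,d_B)$ of nonincreasing sequences of the degrees of the vertices in $A$ and in $B$, respectively; a pair of sequences is a bipartite degree sequence if it arises this way from some bipartite graph, called a realization. The matching number of a graph is the maximum size of a matching. -}

module Defs where

open import Data.Nat using (ℕ; _≤_)
open import Data.Bool using (Bool; true; false; T)
open import Data.Fin using (Fin)
open import Data.List using (List; map)
open import Data.Nat.ListAction using (sum)
open import Data.List.Base using (allFin)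
open import Data.Product using (Σ; _×_; ∃)
open import Function.Definitions using (Injective)
open import Relation.Binary.PropositionalEquality using (_≡_)

BipGraph : ℕ → ℕ → Set
BipGraph m n = Fin m → Fin n → Bool

indicator : Bool → ℕ
indicator true  = 1
indicator false = 0

degA : ∀ {m n} → BipGraph m n → Fin m → ℕ
degA {n = n} G a = sum (map (λ b → indicator (G a b)) (allFin n))

degB : ∀ {m n} → BipGraph m n → Fin n → ℕ
degB {m = m} G b = sum (map (λ a → indicator (G a b)) (allFin m))

Nonincreasing : ∀ {k} → (Fin k → ℕ) → Set
Nonincreasing {k} d = ∀ (i j : Fin k) → Data.Fin._≤_ i j → d j ≤ d i

-- (dA , dB) is a bipartite degree sequence: both nonincreasing and realizable
-- G realizes (dA , dB): vertex i of A has degree dA i, vertex j of B has degree dB j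
-- (vertices labelled so that degrees appear in the given nonincreasing order).
Realizes : ∀ {m n} → BipGraph m n → (Fin m → ℕ) → (Fin n → ℕ) → Set
Realizes G dA dB = (∀ a → degA G a ≡ dA a) × (∀ b → degB G b ≡ dB b)

record Matching {m n} (G : BipGraph m n) (k : ℕ) : Set where
  field
    left    : Fin k → Fin m
    right   : Fin k → Fin n
    isEdge  : ∀ i → T (G (left i) (right i))
    leftInj  : Injective _≡_ _≡_ left
    rightInj : Injective _≡_ _≡_ right

MatchingNumber : ∀ {m n} → BipGraph m n → ℕ → Set
MatchingNumber G ν = Matching G ν × (∀ k → Matching G k → k ≤ ν)

module Submission where

-- Ryser: any two realizations of the same bipartite degree sequence are joined by a
-- sequence of 2-switches.  Make the first rows agree by switches that strictly reduce
-- their disagreement (equal column degrees guarantee that G or H admits such a switch),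
-- then recurse on the remaining rows.  A 2-switch lowers the matching number by at most
-- one: a matching loses at most one of the two removed edges, and if it contains both it
-- can use the two added edges instead.  Since 2-switches are reversible, the matching
-- number moves in steps of at most one along the sequence from G₁ to G₂ and so takes
-- every value between νmin and νmax.

open import Defs
open import Data.Nat.Properties
  using ( +-0-commutativeMonoid; ≤-refl; ≤-reflexive; ≤-trans; ≤-antisym; +-mono-≤
        ; +-mono-<-≤; +-mono-≤-<; <⇒≱; m≤n⇒m<n∨m≡n; ≤∧≢⇒<; m<1+n⇒m≤n; m≤n⇒m≤1+n
        ; +-cancelˡ-≡; module ≤-Reasoning)
open import Algebra.Properties.CommutativeMonoid.Sum +-0-commutativeMonoid
  using (sum-cong-≗; sum-permute) renaming (sum to ∑)
open import Data.Bool using (Bool; true; false; T; T?; not; _∧_; _∨_; _xor_)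
import Data.Bool.Properties as Bool
open import Data.Fin using (Fin; zero; suc; punchIn)
open import Data.Fin.Properties
  using (_≟_; any?; all?; injective⇒≤; punchIn-injective; punchInᵢ≢i)
import Data.Fin.Permutation as Perm
open import Data.Fin.Permutation.Components using (transpose; transpose-inverse)
open import Data.List.Base using (tabulate)
open import Data.List.Properties using (map-tabulate)
open import Data.Nat using (ℕ; zero; suc; _+_; _≤_; _<_; z≤n; s≤s)
open import Data.Nat.Induction using (<-wellFounded)
open import Data.Nat.ListAction using (sum)
open import Data.Product using (Σ; ∃; _×_; _,_; proj₁; proj₂; swap)
open import Data.Sum using (_⊎_; inj₁; inj₂)
open import Data.Vec.Functional using (Vector; _∷_; head; tail)
open import Function using (_∘_; id)
open import Function.Definitions using (Injective)
open import Induction.WellFounded using (Acc; acc)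
open import Relation.Binary.Construct.Closure.ReflexiveTransitive using (Star; ε; _◅_; _◅◅_; gmap)
open import Relation.Binary.PropositionalEquality
open import Relation.Nullary using (¬_; Dec; yes; no; does; contradiction)
open import Relation.Nullary.Decidable using (map′; _×-dec_; _→-dec_; dec-true; dec-false)

private
  variable
    k m n : ℕ
    c d x : Fin n

count : (Fin n → Bool) → ℕ
count f = ∑ (indicator ∘ f)

sum-tabulate : (f : Fin n → ℕ) → sum (tabulate f) ≡ ∑ f
sum-tabulate {zero}  f = refl
sum-tabulate {suc n} f = cong (f zero +_) (sum-tabulate (f ∘ suc))

degA≡count : (G : BipGraph m n) (a : Fin m) → degA G a ≡ count (G a)
degA≡count G a =
  trans (cong sum (map-tabulate id (indicator ∘ G a))) (sum-tabulate (indicator ∘ G a))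

count-transpose : (f : Fin n → Bool) (c d : Fin n) → count (f ∘ transpose c d) ≡ count f
count-transpose f c d = sym (sum-permute (indicator ∘ f) (Perm.transpose c d))

∑-mono-≤ : {f g : Fin n → ℕ} → (∀ i → f i ≤ g i) → ∑ f ≤ ∑ g
∑-mono-≤ {zero}  f≤g = z≤n
∑-mono-≤ {suc n} f≤g = +-mono-≤ (f≤g zero) (∑-mono-≤ (f≤g ∘ suc))

∑-mono-< : {f g : Fin n → ℕ} → (∀ i → f i ≤ g i) → (c : Fin n) → f c < g c → ∑ f < ∑ g
∑-mono-< f≤g zero    fc<gc = +-mono-<-≤ fc<gc (∑-mono-≤ (f≤g ∘ suc))
∑-mono-< f≤g (suc c) fc<gc = +-mono-≤-< (f≤g zero) (∑-mono-< (f≤g ∘ suc) c fc<gc)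

∑-mono-≤-≗ : {f g : Fin n → ℕ} → (∀ i → f i ≤ g i) → ∑ g ≤ ∑ f → f ≗ g
∑-mono-≤-≗ f≤g ∑g≤∑f i with m≤n⇒m<n∨m≡n (f≤g i)
... | inj₁ fi<gi = contradiction ∑g≤∑f (<⇒≱ (∑-mono-< f≤g i fi<gi))
... | inj₂ fi≡gi = fi≡gi

indicator-injective : ∀ {p q} → indicator p ≡ indicator q → p ≡ q
indicator-injective {false} {false} _ = refl
indicator-injective {true}  {true}  _ = refl

indicator-mono : ∀ {p q} → ¬ (p ≡ true × q ≡ false) → indicator p ≤ indicator q
indicator-mono {false} _ = z≤n
indicator-mono {true} {true} _ = ≤-refl
indicator-mono {true} {false} ¬tf = contradiction (refl , refl) ¬tf

count-mono : {r s : Fin n → Bool} → (∀ x → ¬ (r x ≡ true × s x ≡ false)) → count r ≤ count s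
count-mono r≤s = ∑-mono-≤ (indicator-mono ∘ r≤s)

count-≡-witness : (r s : Fin n → Bool) → count r ≡ count s → ¬ (r ≗ s) →
                  ∃ λ x → r x ≡ true × s x ≡ false
count-≡-witness r s #r≡#s r≉s with any? (λ x → (r x Bool.≟ true) ×-dec (s x Bool.≟ false))
... | yes witness = witness
... | no ¬witness =
  contradiction (indicator-injective ∘ ∑-mono-≤-≗ r≤s (≤-reflexive (sym #r≡#s))) r≉s
  where
  r≤s : ∀ x → indicator (r x) ≤ indicator (s x)
  r≤s x = indicator-mono λ tf → ¬witness (x , tf)

dist : (r s : Fin n → Bool) → ℕ
dist r s = count λ x → r x xor s x

dist-comm : (r s : Fin n → Bool) → dist r s ≡ dist s r
dist-comm r s = sum-cong-≗ λ x → cong indicator (Bool.xor-comm (r x) (s x))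

flip-disagreements : (p r s : Fin n → Bool) → (∀ x → p x ≡ true → r x ≢ s x) → p c ≡ true →
                     dist (λ x → p x xor r x) s < dist r s
flip-disagreements {c = c} p r s p⇒≢ pc≡true =
  ∑-mono-< (λ x → ≤-pointwise (p⇒≢ x)) c (<-at pc≡true (p⇒≢ c pc≡true))
  where
  ≤-pointwise : ∀ {p r s} → (p ≡ true → r ≢ s) → indicator ((p xor r) xor s) ≤ indicator (r xor s)
  ≤-pointwise {false}              _ = ≤-refl
  ≤-pointwise {true} {true}  {true}  h = contradiction refl (h refl)
  ≤-pointwise {true} {true}  {false} _ = z≤n
  ≤-pointwise {true} {false} {true}  _ = z≤n
  ≤-pointwise {true} {false} {false} h = contradiction refl (h refl)
  <-at : ∀ {p r s} → p ≡ true → r ≢ s → indicator ((p xor r) xor s) < indicator (r xor s)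
  <-at {r = true}  {true}  refl r≢s = contradiction refl r≢s
  <-at {r = true}  {false} refl _   = s≤s z≤n
  <-at {r = false} {true}  refl _   = s≤s z≤n
  <-at {r = false} {false} refl r≢s = contradiction refl r≢s

pair : Fin n → Fin n → Fin n → Bool
pair c d x = does (x ≟ c) ∨ does (x ≟ d)

pair-fst : (c d : Fin n) → pair c d c ≡ true
pair-fst c d = cong (_∨ does (c ≟ d)) (dec-true (c ≟ c) refl)

pair-snd : (c d : Fin n) → pair c d d ≡ true
pair-snd c d = trans (Bool.∨-comm (does (d ≟ c)) _) (pair-fst d c)

pair-comm : (c d x : Fin n) → pair c d x ≡ pair d c x
pair-comm c d x = Bool.∨-comm (does (x ≟ c)) (does (x ≟ d))

pair-other : x ≢ c → x ≢ d → pair c d x ≡ false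
pair-other {x = x} {c} {d} x≢c x≢d = cong₂ _∨_ (dec-false (x ≟ c) x≢c) (dec-false (x ≟ d) x≢d)

pair-true : pair c d x ≡ true → x ≡ c ⊎ x ≡ d
pair-true {c = c} {d} {x} _ with x ≟ c | x ≟ d
pair-true _ | yes x≡c | _       = inj₁ x≡c
pair-true _ | no _    | yes x≡d = inj₂ x≡d
pair-true () | no _   | no _

transpose-other : x ≢ c → x ≢ d → transpose c d x ≡ x
transpose-other {x = x} {c} {d} x≢c x≢d with x ≟ c
... | yes x≡c = contradiction x≡c x≢c
... | no _ with x ≟ d
...   | yes x≡d = contradiction x≡d x≢d
...   | no _ = refl

flip-pair : (f : Fin n → Bool) → f c ≢ f d → ∀ x → pair c d x xor f x ≡ f (transpose c d x)
flip-pair {c = c} {d} f fc≢fd x with x ≟ c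
... | yes refl = sym (Bool.¬-not (fc≢fd ∘ sym))
... | no _ with x ≟ d
...   | yes refl = sym (Bool.¬-not fc≢fd)
...   | no _ = refl

transpose-injective : (c d : Fin n) {x y : Fin n} → transpose c d x ≡ transpose c d y → x ≡ y
transpose-injective c d {x} {y} eq = begin
  x                               ≡⟨ transpose-inverse d c ⟨
  transpose d c (transpose c d x) ≡⟨ cong (transpose d c) eq ⟩
  transpose d c (transpose c d y) ≡⟨ transpose-inverse d c ⟩
  y                               ∎
  where open ≡-Reasoning

true-false-≢ : ∀ {p q} → p ≡ true → q ≡ false → p ≢ q
true-false-≢ refl refl ()

xor-cancelˡ : ∀ p q → p xor (p xor q) ≡ q
xor-cancelˡ false q = refl
xor-cancelˡ true  q = Bool.not-involutive q

-- Degrees and 2-switches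

_ᵀ : BipGraph m n → BipGraph n m
(G ᵀ) b a = G a b

Realizes-ᵀ : ∀ {G : BipGraph m n} {dA dB} → Realizes G dA dB → Realizes (G ᵀ) dB dA
Realizes-ᵀ = swap

same-row-count : ∀ {G H : BipGraph m n} {dA dB} → Realizes G dA dB → Realizes H dA dB →
                 ∀ a → count (G a) ≡ count (H a)
same-row-count {G = G} {H} (degA-G , _) (degA-H , _) a =
  trans (sym (degA≡count G a)) (trans (trans (degA-G a) (sym (degA-H a))) (degA≡count H a))

_≋_ : BipGraph m n → BipGraph m n → Set
G ≋ H = ∀ a b → G a b ≡ H a b

≗-degA : {G H : BipGraph m n} (a : Fin m) → G a ≗ H a → degA G a ≡ degA H a
≗-degA {G = G} {H} a Ga≗Ha =
  trans (degA≡count G a) (trans (sum-cong-≗ (cong indicator ∘ Ga≗Ha)) (sym (degA≡count H a)))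

≋-realizes : ∀ {G H : BipGraph m n} {dA dB} → G ≋ H → Realizes G dA dB → Realizes H dA dB
≋-realizes {G = G} {H} G≋H (degA≡dA , degB≡dB) =
  (λ a → trans (≗-degA {G = H} {G} a λ b → sym (G≋H a b)) (degA≡dA a)) ,
  (λ b → trans (≗-degA {G = H ᵀ} {G ᵀ} b λ a → sym (G≋H a b)) (degB≡dB b))

switch : BipGraph m n → Fin m → Fin m → Fin n → Fin n → BipGraph m n
switch G a₁ a₂ b₁ b₂ a b = (pair a₁ a₂ a ∧ pair b₁ b₂ b) xor G a b

-- In G the block {a₁, a₂} × {b₁, b₂} is the alternating 4-cycle a₁b₁a₂b₂; toggling the
-- block (the xor in switch) trades the edges a₁b₁, a₂b₂ for a₁b₂, a₂b₁.
record Switch (G H : BipGraph m n) : Set where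
  field
    a₁ a₂  : Fin m
    b₁ b₂  : Fin n
    G-a₁b₁ : G a₁ b₁ ≡ true
    G-a₂b₂ : G a₂ b₂ ≡ true
    G-a₁b₂ : G a₁ b₂ ≡ false
    G-a₂b₁ : G a₂ b₁ ≡ false
    flips  : ∀ a b → H a b ≡ switch G a₁ a₂ b₁ b₂ a b

  row-outside : ∀ {a} → a ≢ a₁ → a ≢ a₂ → H a ≗ G a
  row-outside {a} a≢a₁ a≢a₂ b =
    trans (flips a b) (cong (λ p → (p ∧ pair b₁ b₂ b) xor G a b) (pair-other a≢a₁ a≢a₂))

  row-inside : ∀ {a} → a ≡ a₁ ⊎ a ≡ a₂ → H a ≗ G a ∘ transpose b₁ b₂
  row-inside (inj₁ refl) b = trans (flips a₁ b)
    (trans (cong (λ p → (p ∧ pair b₁ b₂ b) xor G a₁ b) (pair-fst a₁ a₂))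
           (flip-pair (G a₁) (true-false-≢ G-a₁b₁ G-a₁b₂) b))
  row-inside (inj₂ refl) b = trans (flips a₂ b)
    (trans (cong (λ p → (p ∧ pair b₁ b₂ b) xor G a₂ b) (pair-snd a₁ a₂))
           (flip-pair (G a₂) (≢-sym (true-false-≢ G-a₂b₂ G-a₂b₁)) b))

  count-row-inside : ∀ {a} → a ≡ a₁ ⊎ a ≡ a₂ → count (H a) ≡ count (G a)
  count-row-inside {a} a∈ =
    trans (sum-cong-≗ (cong indicator ∘ row-inside a∈)) (count-transpose (G a) b₁ b₂)

  count-row : ∀ a → count (H a) ≡ count (G a)
  count-row a with a ≟ a₁ | a ≟ a₂
  ... | no a≢a₁  | no a≢a₂  = sum-cong-≗ (cong indicator ∘ row-outside a≢a₁ a≢a₂)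
  ... | yes a≡a₁ | _        = count-row-inside (inj₁ a≡a₁)
  ... | no _     | yes a≡a₂ = count-row-inside (inj₂ a≡a₂)

  kept : ∀ {a b} → T (G a b) → ¬ (a ≡ a₁ × b ≡ b₁) → ¬ (a ≡ a₂ × b ≡ b₂) → T (H a b)
  kept {a} {b} Gab ¬a₁b₁ ¬a₂b₂ with a ≟ a₁ | a ≟ a₂
  ... | no a≢a₁ | no a≢a₂ = subst T (sym (row-outside a≢a₁ a≢a₂ b)) Gab
  ... | yes refl | _ =
    subst T (sym (trans (row-inside (inj₁ refl) b) (cong (G a) (transpose-other b≢b₁ b≢b₂)))) Gab
    where
    b≢b₁ : b ≢ b₁
    b≢b₁ b≡b₁ = ¬a₁b₁ (refl , b≡b₁)
    b≢b₂ : b ≢ b₂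
    b≢b₂ refl = subst T G-a₁b₂ Gab
  ... | no _ | yes refl =
    subst T (sym (trans (row-inside (inj₂ refl) b) (cong (G a) (transpose-other b≢b₁ b≢b₂)))) Gab
    where
    b≢b₁ : b ≢ b₁
    b≢b₁ refl = subst T G-a₂b₁ Gab
    b≢b₂ : b ≢ b₂
    b≢b₂ b≡b₂ = ¬a₂b₂ (refl , b≡b₂)

  degA-preserved : ∀ a → degA H a ≡ degA G a
  degA-preserved a = trans (degA≡count H a) (trans (count-row a) (sym (degA≡count G a)))

switching : (G : BipGraph m n) {a₁ a₂ : Fin m} {b₁ b₂ : Fin n} →
            G a₁ b₁ ≡ true → G a₂ b₂ ≡ true → G a₁ b₂ ≡ false → G a₂ b₁ ≡ false →
            Switch G (switch G a₁ a₂ b₁ b₂)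
switching G {a₁} {a₂} {b₁} {b₂} G-a₁b₁ G-a₂b₂ G-a₁b₂ G-a₂b₁ = record
  { a₁ = a₁ ; a₂ = a₂ ; b₁ = b₁ ; b₂ = b₂
  ; G-a₁b₁ = G-a₁b₁ ; G-a₂b₂ = G-a₂b₂ ; G-a₁b₂ = G-a₁b₂ ; G-a₂b₁ = G-a₂b₁
  ; flips = λ _ _ → refl
  }

Switch-sym : {G H : BipGraph m n} → Switch G H → Switch H G
Switch-sym {G = G} {H} s = record
  { a₁ = a₁ ; a₂ = a₂ ; b₁ = b₂ ; b₂ = b₁
  ; G-a₁b₁ = trans (flipped (pair-fst a₁ a₂) (pair-snd b₁ b₂)) (cong not G-a₁b₂)
  ; G-a₂b₂ = trans (flipped (pair-snd a₁ a₂) (pair-fst b₁ b₂)) (cong not G-a₂b₁)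
  ; G-a₁b₂ = trans (flipped (pair-fst a₁ a₂) (pair-fst b₁ b₂)) (cong not G-a₁b₁)
  ; G-a₂b₁ = trans (flipped (pair-snd a₁ a₂) (pair-snd b₁ b₂)) (cong not G-a₂b₂)
  ; flips = unflips
  }
  where
  open Switch s
  flipped : ∀ {a b} → pair a₁ a₂ a ≡ true → pair b₁ b₂ b ≡ true → H a b ≡ not (G a b)
  flipped {a} {b} pa pb = trans (flips a b) (cong₂ (λ p q → (p ∧ q) xor G a b) pa pb)
  unflips : ∀ a b → G a b ≡ switch H a₁ a₂ b₂ b₁ a b
  unflips a b = begin
    G a b                       ≡⟨ xor-cancelˡ block (G a b) ⟨
    block xor (block xor G a b) ≡⟨ cong (block xor_) (flips a b) ⟨
    block xor H a b             ≡⟨ cong (λ q → (pair a₁ a₂ a ∧ q) xor H a b) (pair-comm b₁ b₂ b) ⟩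
    switch H a₁ a₂ b₂ b₁ a b    ∎
    where
    open ≡-Reasoning
    block = pair a₁ a₂ a ∧ pair b₁ b₂ b

Switch-ᵀ : {G H : BipGraph m n} → Switch G H → Switch (G ᵀ) (H ᵀ)
Switch-ᵀ {G = G} s = record
  { a₁ = b₁ ; a₂ = b₂ ; b₁ = a₁ ; b₂ = a₂
  ; G-a₁b₁ = G-a₁b₁ ; G-a₂b₂ = G-a₂b₂ ; G-a₁b₂ = G-a₂b₁ ; G-a₂b₁ = G-a₁b₂
  ; flips = λ b a →
      trans (flips a b) (cong (_xor G a b) (Bool.∧-comm (pair a₁ a₂ a) (pair b₁ b₂ b)))
  }
  where open Switch s

Switch-realizes : ∀ {G H : BipGraph m n} {dA dB} → Switch G H → Realizes G dA dB → Realizes H dA dB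
Switch-realizes s (degA≡dA , degB≡dB) =
  (λ a → trans (Switch.degA-preserved s a) (degA≡dA a)) ,
  (λ b → trans (Switch.degA-preserved (Switch-ᵀ s) b) (degB≡dB b))

-- Matchings

open Matching

Matching-mono : {G H : BipGraph m n} → (∀ a b → T (G a b) → T (H a b)) →
                Matching G k → Matching H k
Matching-mono G⊆H M = record
  { left = left M ; right = right M
  ; isEdge = λ i → G⊆H _ _ (isEdge M i)
  ; leftInj = leftInj M ; rightInj = rightInj M
  }

remove-edge : {G H : BipGraph m n} (M : Matching G (suc k)) (r : Fin (suc k)) →
              (∀ i → i ≢ r → T (H (left M i) (right M i))) → Matching H k
remove-edge M r others∈H = record
  { left = left M ∘ punchIn r ; right = right M ∘ punchIn r
  ; isEdge = λ i → others∈H (punchIn r i) (punchInᵢ≢i r i)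
  ; leftInj = punchIn-injective r _ _ ∘ leftInj M
  ; rightInj = punchIn-injective r _ _ ∘ rightInj M
  }

module _ {G H : BipGraph m n} (s : Switch G H) (M : Matching G (suc k)) where
  open Switch s

  private
    Uses : Fin m → Fin n → Fin (suc k) → Set
    Uses a b i = left M i ≡ a × right M i ≡ b

    uses-unique : ∀ {a b i j} → Uses a b i → Uses a b j → i ≡ j
    uses-unique (li≡a , _) (lj≡a , _) = leftInj M (trans li≡a (sym lj≡a))

    -- Exchanging b₁ and b₂ turns the matching edges a₁b₁, a₂b₂ into a₁b₂, a₂b₁.
    reroute : ∀ {i₁ i₂} → Uses a₁ b₁ i₁ → Uses a₂ b₂ i₂ → Matching H (suc k)
    reroute (l₁ , r₁) (l₂ , r₂) = record
      { left = left M ; right = transpose b₂ b₁ ∘ right M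
      ; isEdge = edge ; leftInj = leftInj M
      ; rightInj = rightInj M ∘ transpose-injective b₂ b₁
      }
      where
      inside : ∀ i → left M i ≡ a₁ ⊎ left M i ≡ a₂ →
               T (H (left M i) (transpose b₂ b₁ (right M i)))
      inside i l = subst T
        (sym (trans (row-inside l _) (cong (G (left M i)) (transpose-inverse b₁ b₂))))
        (isEdge M i)
      edge : ∀ i → T (H (left M i) (transpose b₂ b₁ (right M i)))
      edge i with left M i ≟ a₁ | left M i ≟ a₂
      ... | yes l≡a₁ | _        = inside i (inj₁ l≡a₁)
      ... | no _     | yes l≡a₂ = inside i (inj₂ l≡a₂)
      ... | no l≢a₁  | no l≢a₂  = subst T
            (sym (trans (row-outside l≢a₁ l≢a₂ _) (cong (G (left M i)) (transpose-other r≢b₂ r≢b₁))))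
            (isEdge M i)
        where
        r≢b₁ : right M i ≢ b₁
        r≢b₁ r≡b₁ = l≢a₁ (trans (cong (left M) (rightInj M (trans r≡b₁ (sym r₁)))) l₁)
        r≢b₂ : right M i ≢ b₂
        r≢b₂ r≡b₂ = l≢a₂ (trans (cong (left M) (rightInj M (trans r≡b₂ (sym r₂)))) l₂)

    remove-all-but : (r : Fin (suc k)) →
                     (∀ i → i ≢ r → ¬ Uses a₁ b₁ i) → (∀ i → i ≢ r → ¬ Uses a₂ b₂ i) →
                     Matching H k
    remove-all-but r ¬u₁ ¬u₂ = remove-edge M r (λ i i≢r → kept (isEdge M i) (¬u₁ i i≢r) (¬u₂ i i≢r))

  Switch-matching : Matching H k
  Switch-matching with any? (λ i → (left M i ≟ a₁) ×-dec (right M i ≟ b₁))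
                     | any? (λ i → (left M i ≟ a₂) ×-dec (right M i ≟ b₂))
  ... | yes (_ , u₁) | yes (_ , u₂) = remove-edge M′ zero (λ i _ → isEdge M′ i)
    where M′ = reroute u₁ u₂
  ... | yes (i₁ , u₁) | no ¬u₂ =
    remove-all-but i₁ (λ i i≢i₁ u → i≢i₁ (uses-unique u u₁)) (λ i _ u → ¬u₂ (i , u))
  ... | no ¬u₁ | yes (i₂ , u₂) =
    remove-all-but i₂ (λ i _ u → ¬u₁ (i , u)) (λ i i≢i₂ u → i≢i₂ (uses-unique u u₂))
  ... | no ¬u₁ | no ¬u₂ =
    remove-all-but zero (λ i _ u → ¬u₁ (i , u)) (λ i _ u → ¬u₂ (i , u))

∃-vector? : ∀ k {P : Vector (Fin m) k → Set} → (∀ {f g} → f ≗ g → P f → P g) →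
            (∀ f → Dec (P f)) → Dec (∃ P)
∃-vector? zero    resp P? = map′ (λ p → _ , p) (λ (f , p) → resp (λ ()) p) (P? λ ())
∃-vector? (suc k) resp P? =
  map′ (λ (x , f , p) → x ∷ f , p)
       (λ (f , p) → head f , tail f , resp (λ { zero → refl ; (suc i) → refl }) p)
       (any? λ x → ∃-vector? k (λ f≗g → resp (λ { zero → refl ; (suc i) → f≗g i })) (P? ∘ (x ∷_)))

Injective? : (f : Fin k → Fin m) → Dec (Injective _≡_ _≡_ f)
Injective? f = map′ (λ inj {i} {j} → inj i j) (λ inj i j → inj)
                    (all? λ i → all? λ j → (f i ≟ f j) →-dec (i ≟ j))

Matching? : (G : BipGraph m n) (k : ℕ) → Dec (Matching G k)
Matching? G k =
  map′ (λ (L , R , e , il , ir) →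
          record { left = L ; right = R ; isEdge = e ; leftInj = il ; rightInj = ir })
       (λ M → left M , right M , isEdge M , (λ {i j} → leftInj M) , (λ {i j} → rightInj M))
       (∃-vector? k respL λ L → ∃-vector? k (respR L) λ R →
          all? (λ i → T? (G (L i) (R i))) ×-dec Injective? L ×-dec Injective? R)
  where
  IsMatching : (Fin k → Fin _) → (Fin k → Fin _) → Set
  IsMatching L R = (∀ i → T (G (L i) (R i))) × Injective _≡_ _≡_ L × Injective _≡_ _≡_ R
  respR : ∀ L {R R′} → R ≗ R′ → IsMatching L R → IsMatching L R′
  respR L R≗R′ (e , il , ir) =
    (λ i → subst (T ∘ G (L i)) (R≗R′ i) (e i)) , il ,
    (λ {i} {j} eq → ir (trans (R≗R′ i) (trans eq (sym (R≗R′ j)))))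
  respL : ∀ {L L′} → L ≗ L′ → ∃ (IsMatching L) → ∃ (IsMatching L′)
  respL L≗L′ (R , e , il , ir) =
    R , (λ i → subst (λ a → T (G a (R i))) (L≗L′ i) (e i)) ,
    (λ {i} {j} eq → il (trans (L≗L′ i) (trans eq (sym (L≗L′ j))))) , ir

empty-matching : (G : BipGraph m n) → Matching G 0
empty-matching G = record
  { left = λ () ; right = λ () ; isEdge = λ () ; leftInj = λ { {()} } ; rightInj = λ { {()} } }

maximum-exists : {P : ℕ → Set} → (∀ k → Dec (P k)) → P 0 → ∀ B → (∀ k → P k → k ≤ B) →
                 ∃ λ ν → P ν × (∀ k → P k → k ≤ ν)
maximum-exists P? P0 zero    ≤B = 0 , P0 , ≤B
maximum-exists P? P0 (suc B) ≤B with P? (suc B)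
... | yes P[1+B] = suc B , P[1+B] , ≤B
... | no ¬P[1+B] = maximum-exists P? P0 B λ k Pk →
  m<1+n⇒m≤n (≤∧≢⇒< (≤B k Pk) λ { refl → ¬P[1+B] Pk })

matchingNumber-exists : (G : BipGraph m n) → ∃ (MatchingNumber G)
matchingNumber-exists {m} G =
  maximum-exists (Matching? G) (empty-matching G) m (λ k M → injective⇒≤ (leftInj M))

matchingNumber : BipGraph m n → ℕ
matchingNumber G = proj₁ (matchingNumber-exists G)

matchingNumber-spec : (G : BipGraph m n) → MatchingNumber G (matchingNumber G)
matchingNumber-spec G = proj₂ (matchingNumber-exists G)

MatchingNumber-unique : ∀ {G : BipGraph m n} {ν ν′} →
                        MatchingNumber G ν → MatchingNumber G ν′ → ν ≡ ν′
MatchingNumber-unique (M , max) (M′ , max′) = ≤-antisym (max′ _ M) (max _ M′)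

Switch-MatchingNumber : ∀ {G H : BipGraph m n} {ν ν′} → Switch G H →
                        MatchingNumber G ν → MatchingNumber H ν′ → ν′ ≤ suc ν
Switch-MatchingNumber {ν′ = zero}  s _          _        = z≤n
Switch-MatchingNumber {ν′ = suc k} s (_ , maxG) (MH , _) =
  s≤s (maxG k (Switch-matching (Switch-sym s) MH))

intermediate-value : {A : Set} {R : A → A → Set} {P : A → Set} (f : A → ℕ) →
                     (∀ {x y} → R x y → f y ≤ suc (f x)) → (∀ {x y} → R x y → P x → P y) →
                     ∀ {x y ν} → Star R x y → P x → f x ≤ ν → ν ≤ f y → ∃ λ z → P z × f z ≡ ν
intermediate-value f step-≤ step-P ε Px fx≤ν ν≤fy = _ , Px , ≤-antisym fx≤ν ν≤fy
intermediate-value f step-≤ step-P {x} (xRy ◅ y⇝z) Px fx≤ν ν≤fz with m≤n⇒m<n∨m≡n fx≤ν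
... | inj₂ fx≡ν = x , Px , fx≡ν
... | inj₁ fx<ν =
  intermediate-value f step-≤ step-P y⇝z (step-P xRy Px) (≤-trans (step-≤ xRy) fx<ν) ν≤fz

_↝_ : BipGraph m n → BipGraph m n → Set
G ↝ H = G ≋ H ⊎ Switch G H

_↝*_ : BipGraph m n → BipGraph m n → Set
_↝*_ = Star _↝_

↝-realizes : ∀ {G H : BipGraph m n} {dA dB} → G ↝ H → Realizes G dA dB → Realizes H dA dB
↝-realizes (inj₁ G≋H) = ≋-realizes G≋H
↝-realizes (inj₂ s)   = Switch-realizes s

↝-matchingNumber : {G H : BipGraph m n} → G ↝ H → matchingNumber H ≤ suc (matchingNumber G)
↝-matchingNumber {G = G} {H} (inj₁ G≋H) = m≤n⇒m≤1+n
  (proj₂ (matchingNumber-spec G) _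
     (Matching-mono (λ a b → subst T (sym (G≋H a b))) (proj₁ (matchingNumber-spec H))))
↝-matchingNumber {G = G} {H} (inj₂ s) =
  Switch-MatchingNumber s (matchingNumber-spec G) (matchingNumber-spec H)

-- Connectivity of realizations

_◁_ : (Fin n → Bool) → BipGraph m n → BipGraph (suc m) n
(r ◁ G) zero    = r
(r ◁ G) (suc a) = G a

◁-↝ : ∀ (r : Fin n → Bool) {G H : BipGraph m n} → G ↝ H → (r ◁ G) ↝ (r ◁ H)
◁-↝ r (inj₁ G≋H) = inj₁ λ { zero b → refl ; (suc a) b → G≋H a b }
◁-↝ r (inj₂ s)   = inj₂ record
  { a₁ = suc a₁ ; a₂ = suc a₂ ; b₁ = b₁ ; b₂ = b₂
  ; G-a₁b₁ = G-a₁b₁ ; G-a₂b₂ = G-a₂b₂ ; G-a₁b₂ = G-a₁b₂ ; G-a₂b₁ = G-a₂b₁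
  ; flips = λ { zero b → refl ; (suc a) b → flips a b }
  }
  where open Switch s

rows-agree : {G H : BipGraph (suc m) n} → G zero ≗ H zero → (G ∘ suc) ↝* (H ∘ suc) → G ↝* H
rows-agree {G = G} row₀≗ tails =
  inj₁ (λ { zero b → refl ; (suc a) b → refl }) ◅
  gmap (G zero ◁_) (◁-↝ (G zero)) tails ◅◅
  inj₁ (λ { zero b → row₀≗ b ; (suc a) b → refl }) ◅ ε

degB-suc : (G : BipGraph (suc m) n) (b : Fin n) →
           degB G b ≡ indicator (G zero b) + degB (G ∘ suc) b
degB-suc G b =
  trans (degA≡count (G ᵀ) b) (cong (indicator (G zero b) +_) (sym (degA≡count ((G ∘ suc) ᵀ) b)))

tail-realizes : ∀ {G H : BipGraph (suc m) n} {dA dB} → Realizes G dA dB → Realizes H dA dB →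
                G zero ≗ H zero → Realizes (H ∘ suc) (dA ∘ suc) (degB (G ∘ suc))
tail-realizes {G = G} {H} (_ , degB-G) (degA-H , degB-H) row₀≗ =
  degA-H ∘ suc , λ b → +-cancelˡ-≡ _ _ _ (begin
  indicator (G zero b) + degB (H ∘ suc) b ≡⟨ cong (λ p → indicator p + _) (row₀≗ b) ⟩
  indicator (H zero b) + degB (H ∘ suc) b ≡⟨ degB-suc H b ⟨
  degB H b                                ≡⟨ trans (degB-H b) (sym (degB-G b)) ⟩
  degB G b                                ≡⟨ degB-suc G b ⟩
  indicator (G zero b) + degB (G ∘ suc) b ∎)
  where open ≡-Reasoning

-- If neither G nor H has a switch on columns b, b′ then column b′ dominates column b in G
-- while b dominates b′ in H; equal column degrees force column b′ = column b in G.
switchable : ∀ {G H : BipGraph m n} {dA dB} → Realizes G dA dB → Realizes H dA dB →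
             ∀ {a₀ b b′} → G a₀ b ≡ true → G a₀ b′ ≡ false →
             (∃ λ a → G a b′ ≡ true × G a b ≡ false) ⊎ (∃ λ a → H a b ≡ true × H a b′ ≡ false)
switchable {G = G} {H} rG rH {a₀} {b} {b′} Ga₀b Ga₀b′
  with any? (λ a → (G a b′ Bool.≟ true) ×-dec (G a b Bool.≟ false))
     | any? (λ a → (H a b Bool.≟ true) ×-dec (H a b′ Bool.≟ false))
... | yes inG | _       = inj₁ inG
... | no _    | yes inH = inj₂ inH
... | no ¬inG | no ¬inH =
  contradiction (trans (cong indicator (sym Ga₀b′)) (trans (b′≗b a₀) (cong indicator Ga₀b))) λ ()
  where
  #b≤#b′ : count ((G ᵀ) b) ≤ count ((G ᵀ) b′)
  #b≤#b′ = begin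
    count ((G ᵀ) b)  ≡⟨ same-row-count (Realizes-ᵀ rG) (Realizes-ᵀ rH) b ⟩
    count ((H ᵀ) b)  ≤⟨ count-mono (λ a tf → ¬inH (a , tf)) ⟩
    count ((H ᵀ) b′) ≡⟨ same-row-count (Realizes-ᵀ rH) (Realizes-ᵀ rG) b′ ⟩
    count ((G ᵀ) b′) ∎
    where open ≤-Reasoning
  b′≗b : ∀ a → indicator (G a b′) ≡ indicator (G a b)
  b′≗b = ∑-mono-≤-≗ (λ a → indicator-mono λ tf → ¬inG (a , tf)) #b≤#b′

closer-by-switch : (G : BipGraph (suc m) n) (s : Fin n → Bool) {a : Fin (suc m)} {b b′ : Fin n} →
                   G zero b ≡ true → s b ≡ false → G zero b′ ≡ false → s b′ ≡ true →
                   G a b′ ≡ true → G a b ≡ false →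
                   ∃ λ G′ → Switch G G′ × dist (G′ zero) s < dist (G zero) s
closer-by-switch G s {a} {b} {b′} G₀b sb G₀b′ sb′ Gab′ Gab =
  switch G zero a b b′ , switching G G₀b Gab′ G₀b′ Gab ,
  flip-disagreements {c = b} (pair b b′) (G zero) s disagree (pair-fst b b′)
  where
  disagree : ∀ x → pair b b′ x ≡ true → G zero x ≢ s x
  disagree x p with pair-true {c = b} {b′} {x} p
  ... | inj₁ refl = true-false-≢ G₀b sb
  ... | inj₂ refl = ≢-sym (true-false-≢ sb′ G₀b′)

row₀-closer : ∀ {G H : BipGraph (suc m) n} {dA dB} → Realizes G dA dB → Realizes H dA dB →
              ¬ (G zero ≗ H zero) →
              (∃ λ G′ → Switch G G′ × dist (G′ zero) (H zero) < dist (G zero) (H zero)) ⊎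
              (∃ λ H′ → Switch H H′ × dist (G zero) (H′ zero) < dist (G zero) (H zero))
row₀-closer {G = G} {H} rG rH row₀≉
  with count-≡-witness (G zero) (H zero) (same-row-count rG rH zero) row₀≉
     | count-≡-witness (H zero) (G zero) (same-row-count rH rG zero) (λ e → row₀≉ (sym ∘ e))
... | b , G₀b , H₀b | b′ , H₀b′ , G₀b′ with switchable rG rH G₀b G₀b′
...   | inj₁ (_ , Gab′ , Gab) = inj₁ (closer-by-switch G (H zero) G₀b H₀b G₀b′ H₀b′ Gab′ Gab)
...   | inj₂ (_ , Hab , Hab′) with closer-by-switch H (G zero) H₀b′ G₀b′ H₀b G₀b Hab Hab′
...     | H′ , s , closer =
  inj₂ (H′ , s , subst₂ _<_ (dist-comm (H′ zero) (G zero)) (dist-comm (H zero) (G zero)) closer)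

connected : ∀ {G H : BipGraph m n} {dA dB} → Realizes G dA dB → Realizes H dA dB → G ↝* H
connected {zero} _ _ = inj₁ (λ ()) ◅ ε
connected {suc m} {dA = dA} {dB} rG rH = align rG rH (<-wellFounded _)
  where
  align : ∀ {G H : BipGraph (suc m) _} → Realizes G dA dB → Realizes H dA dB →
          Acc _<_ (dist (G zero) (H zero)) → G ↝* H
  align {G} {H} rG rH (acc closer⇒acc) with all? (λ x → G zero x Bool.≟ H zero x)
  ... | yes row₀≗ =
    rows-agree row₀≗ (connected (proj₁ rG ∘ suc , λ _ → refl) (tail-realizes rG rH row₀≗))
  ... | no row₀≉ with row₀-closer rG rH row₀≉
  ...   | inj₁ (_ , s , closer) = inj₂ s ◅ align (Switch-realizes s rG) rH (closer⇒acc closer)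
  ...   | inj₂ (_ , s , closer) =
    align rG (Switch-realizes s rH) (closer⇒acc closer) ◅◅ inj₂ (Switch-sym s) ◅ ε

theorem5 : ∀ (m n : ℕ) (dA : Fin m → ℕ) (dB : Fin n → ℕ)
           → Nonincreasing dA → Nonincreasing dB
           → (G₁ G₂ : BipGraph m n) → Realizes G₁ dA dB → Realizes G₂ dA dB
           → (νmin νmax ν : ℕ) → MatchingNumber G₁ νmin → MatchingNumber G₂ νmax
           → νmin ≤ ν → ν ≤ νmax
           → Σ (BipGraph m n) (λ G → Realizes G dA dB × MatchingNumber G ν)
theorem5 _ _ _ _ _ _ G₁ G₂ r₁ r₂ _ _ ν is-νmin is-νmax νmin≤ν ν≤νmax
  with intermediate-value matchingNumber ↝-matchingNumber ↝-realizes (connected r₁ r₂) r₁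
         (subst (_≤ ν) (MatchingNumber-unique is-νmin (matchingNumber-spec G₁)) νmin≤ν)
         (subst (ν ≤_) (MatchingNumber-unique is-νmax (matchingNumber-spec G₂)) ν≤νmax)
... | G , rG , νG≡ν = G , rG , subst (MatchingNumber G) νG≡ν (matchingNumber-spec G)
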